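{- Let $a=\frac{1+\sqrt{5}}{2}$ and $b=a^2=a+1$, and put $a_n=[an]$, $b_n=[bn]$ for positive integers $n$. Then the series $$\sum_{n=1}^\infty \left(\frac{a_{n+1}}{a_n}-\frac{b_{n+1}}{b_n}\right)$$ converges.
   Context: $[x]$ denotes the greatest integer not exceeding $x$. -}

module Defs where

open import Data.Nat as ℕ using (ℕ; zero; suc; _*_; _∸_; _^_; _≤_; _<_)
open import Data.Integer using (+_)
open import Data.Rational using (ℚ; 0ℚ; _/_; _+_; _-_)

-- IsFloorHalf p n m  :⇔  m = ⌊ (p + √5) · n / 2 ⌋ , written with integers only:
--   m ≤ (p+√5)n/2  ⇔  (2m ∸ p n)² ≤ 5 n²
--   (p+√5)n/2 < m+1 ⇔  5 n² < (2(m+1) ∸ p n)²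
-- (valid for n ≥ 1; √5 n is irrational so strictness of the bounds is immaterial)
record IsFloorHalf (p n m : ℕ) : Set where
  field
    lower : (2 * m ∸ p * n) ^ 2 ≤ 5 * n ^ 2
    upper : 5 * n ^ 2 < (2 * suc m ∸ p * n) ^ 2

IsFloorA : (ℕ → ℕ) → Set
IsFloorA A = ∀ n → 1 ≤ n → IsFloorHalf 1 n (A n)

IsFloorB : (ℕ → ℕ) → Set
IsFloorB B = ∀ n → 1 ≤ n → IsFloorHalf 3 n (B n)

-- total division of naturals into ℚ; the zero-denominator branch is never used
-- below, since ⌊a n⌋, ⌊b n⌋ ≥ 1 for n ≥ 1
frac : ℕ → ℕ → ℚ
frac p zero    = 0ℚ
frac p (suc q) = (+ p) / suc q

term : (ℕ → ℕ) → (ℕ → ℕ) → ℕ → ℚ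
term A B n = frac (A (suc n)) (A n) - frac (B (suc n)) (B n)

partialSum : (ℕ → ℕ) → (ℕ → ℕ) → ℕ → ℚ
partialSum A B zero    = 0ℚ
partialSum A B (suc N) = partialSum A B N + term A B (suc N)

{-# OPTIONS --safe #-}

-- Write x n = ⌊φ n⌋ with φ = (1 + √5)/2. Since b = φ + 1, ⌊b n⌋ = x n + n, and the n-th term factors as
--   x (n+1) / x n − (x (n+1) + n + 1) / (x n + n) = G n · (V n − V (n+1)),
-- where V n = n / x n and G n = x (n+1) / (x n + n). From x m / m < φ < (x k + 1) / k one gets
-- |V m − V n| ≤ 1/n for n ≤ m, and since x (n+1) − x n ∈ {1, 2}, also 0 ≤ G n ≤ 2 and
-- |G (n+1) − G n| ≤ 3/n. Summation by parts, with V (M+1) standing in for the limit of V, then bounds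
-- the sum of the terms with N < n ≤ M by 5/N.

module Submission where

open import Defs

module _ where
  open import Data.Nat
  open import Data.Nat.Properties
  open import Data.Nat.Tactic.RingSolver using (solve-∀)
  open import Relation.Binary.PropositionalEquality
  open import Algebra.Properties.CommutativeSemiring.Exp +-*-commutativeSemiring using (^-distrib-*)

  private
    ^2-cancel-< : ∀ {a b} → a ^ 2 < b ^ 2 → a < b
    ^2-cancel-< a²<b² = ≰⇒> (λ b≤a → <⇒≱ a²<b² (^-monoˡ-≤ 2 b≤a))

    ∸-cancelʳ-<′ : ∀ {m n} o → m ∸ o < n ∸ o → m < n
    ∸-cancelʳ-<′ o m∸o<n∸o = ≰⇒> (λ n≤m → <⇒≱ m∸o<n∸o (∸-monoˡ-≤ o n≤m))

  -- X / (m+1) < (p + √5)/2 < (Y + 1) / k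
  floorHalf-cross : ∀ {p m k X Y} → IsFloorHalf p (suc m) X → IsFloorHalf p k Y →
                    k * X < suc m * suc Y
  floorHalf-cross {p} {m} {k} {X} {Y} floorX floorY =
    *-cancelˡ-< 2 (k * X) (suc m * suc Y)
      (subst₂ _<_ (double-comm X k) (double-comm (suc Y) M)
        (∸-cancelʳ-<′ (p * M * k)
          (subst₂ _<_ (*-distribʳ-∸ k (2 * X) (p * M))
                      (trans (*-distribʳ-∸ M (2 * suc Y) (p * k)) (cong (2 * suc Y * M ∸_) (swap p k M)))
            (^2-cancel-< (begin-strict
              ((2 * X ∸ p * M) * k) ^ 2     ≡⟨ ^-distrib-* (2 * X ∸ p * M) k 2 ⟩
              (2 * X ∸ p * M) ^ 2 * k ^ 2   ≤⟨ *-monoˡ-≤ (k ^ 2) (IsFloorHalf.lower floorX) ⟩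
              5 * M ^ 2 * k ^ 2             ≡⟨ swap 5 (M ^ 2) (k ^ 2) ⟩
              5 * k ^ 2 * M ^ 2             <⟨ *-monoˡ-< (M ^ 2) (IsFloorHalf.upper floorY) ⟩
              (2 * suc Y ∸ p * k) ^ 2 * M ^ 2 ≡⟨ ^-distrib-* (2 * suc Y ∸ p * k) M 2 ⟨
              ((2 * suc Y ∸ p * k) * M) ^ 2 ∎)))))
    where
    M : ℕ
    M = suc m
    open ≤-Reasoning
    double-comm : ∀ a b → 2 * a * b ≡ 2 * (b * a)
    double-comm = solve-∀
    swap : ∀ a b c → a * b * c ≡ a * c * b
    swap = solve-∀

  floorHalf-unique : ∀ {p m a b} → IsFloorHalf p (suc m) a → IsFloorHalf p (suc m) b → a ≡ b
  floorHalf-unique {m = m} {a} {b} floor-a floor-b = ≤-antisym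
    (s≤s⁻¹ (*-cancelˡ-< (suc m) a (suc b) (floorHalf-cross floor-a floor-b)))
    (s≤s⁻¹ (*-cancelˡ-< (suc m) b (suc a) (floorHalf-cross floor-b floor-a)))

  floorHalf-shift : ∀ {p n X} → IsFloorHalf p n X → IsFloorHalf (2 + p) n (X + n)
  floorHalf-shift {p} {n} {X} floor-X = record
    { lower = subst (λ z → z ^ 2 ≤ 5 * n ^ 2) (sym (shifted X)) (IsFloorHalf.lower floor-X)
    ; upper = subst (λ z → 5 * n ^ 2 < z ^ 2) (sym (shifted (suc X))) (IsFloorHalf.upper floor-X)
    }
    where
    double-+ : ∀ x n → 2 * (x + n) ≡ 2 * n + 2 * x
    double-+ = solve-∀
    shifted : ∀ x → 2 * (x + n) ∸ (2 + p) * n ≡ 2 * x ∸ p * n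
    shifted x = trans (cong₂ _∸_ (double-+ x n) (*-distribʳ-+ n 2 p)) ([m+n]∸[m+o]≡n∸o (2 * n) (2 * x) (p * n))

  n≤floorHalf₁ : ∀ {n X} → IsFloorHalf 1 n X → n ≤ X
  n≤floorHalf₁ {n} {X} floor-X = ≮⇒≥ λ X<n → <⇒≱ (IsFloorHalf.upper floor-X) (begin
    (2 * suc X ∸ 1 * n) ^ 2 ≤⟨ ^-monoˡ-≤ 2 (∸-monoˡ-≤ (1 * n) (*-monoʳ-≤ 2 X<n)) ⟩
    (2 * n ∸ 1 * n) ^ 2     ≡⟨ cong (_^ 2) (trans (sym (*-distribʳ-∸ n 2 1)) (*-identityˡ n)) ⟩
    n ^ 2                   ≤⟨ m≤n*m (n ^ 2) 5 ⟩
    5 * n ^ 2               ∎)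
    where open ≤-Reasoning

  floorHalf₁<2n : ∀ {m X} → IsFloorHalf 1 (suc m) X → X < 2 * suc m
  floorHalf₁<2n {m} {X} floor-X = ≰⇒> λ 2n≤X → <⇒≱ (begin-strict
    5 * n ^ 2               <⟨ *-monoˡ-< (n ^ 2) {5} {9} (s≤s (s≤s (s≤s (s≤s (s≤s (s≤s z≤n)))))) ⟩
    9 * n ^ 2               ≡⟨ ^-distrib-* 3 n 2 ⟨
    (3 * n) ^ 2             ≡⟨ cong (_^ 2) (trans (*-distribʳ-∸ n 4 1) (cong (_∸ 1 * n) (quadruple n))) ⟩
    (2 * (2 * n) ∸ 1 * n) ^ 2 ≤⟨ ^-monoˡ-≤ 2 (∸-monoˡ-≤ (1 * n) (*-monoʳ-≤ 2 2n≤X)) ⟩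
    (2 * X ∸ 1 * n) ^ 2     ∎) (IsFloorHalf.lower floor-X)
    where
    n : ℕ
    n = suc m
    open ≤-Reasoning
    quadruple : ∀ n → 4 * n ≡ 2 * (2 * n)
    quadruple = solve-∀

  module _ {A : ℕ → ℕ} (A-floor : IsFloorA A) where

    n≤A : ∀ {n} → 1 ≤ n → n ≤ A n
    n≤A {n} 1≤n = n≤floorHalf₁ (A-floor n 1≤n)

    A-cross : ∀ {m k} → 1 ≤ m → 1 ≤ k → k * A m < m * suc (A k)
    A-cross {suc m} {k} _ 1≤k = floorHalf-cross (A-floor (suc m) (s≤s z≤n)) (A-floor k 1≤k)

    A-increasing : ∀ {n} → 1 ≤ n → A n < A (suc n)
    A-increasing {n} 1≤n = ≰⇒> λ A[1+n]≤A[n] → <⇒≱ (A-cross 1≤n (s≤s z≤n)) (begin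
      n * suc (A (suc n)) ≤⟨ *-monoʳ-≤ n (s≤s A[1+n]≤A[n]) ⟩
      n * suc (A n)       ≡⟨ *-suc n (A n) ⟩
      n + n * A n         ≤⟨ +-monoˡ-≤ (n * A n) (n≤A 1≤n) ⟩
      suc n * A n         ∎)
      where open ≤-Reasoning

    A-suc≤A+2 : ∀ {n} → 1 ≤ n → A (suc n) ≤ A n + 2
    A-suc≤A+2 {suc m} 1≤n = ≮⇒≥ λ A[n]+2<A[1+n] → <⇒≱ (floorHalf₁<2n (A-floor n 1≤n))
      (s≤s⁻¹ (+-cancelˡ-< n (2 * n) (suc X) (+-cancelˡ-< (n * X) (n + 2 * n) (n + suc X) (begin-strict
        n * X + (n + 2 * n) ≡⟨ expand-left n X ⟩
        n * suc (X + 2)     ≤⟨ *-monoʳ-≤ n A[n]+2<A[1+n] ⟩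
        n * A (suc n)       <⟨ A-cross (s≤s z≤n) 1≤n ⟩
        suc n * suc X       ≡⟨ expand-right n X ⟩
        n * X + (n + suc X) ∎))))
      where
      n X : ℕ
      n = suc m
      X = A n
      open ≤-Reasoning
      expand-left : ∀ n X → n * X + (n + 2 * n) ≡ n * suc (X + 2)
      expand-left = solve-∀
      expand-right : ∀ n X → suc n * suc X ≡ n * X + (n + suc X)
      expand-right = solve-∀

    -- V-cross and the three lemmas after it are the cleared-denominator forms of V j ≤ V i + 1/n,
    -- G n ≤ 2, G (n+1) ≤ G n + 3/n and G n ≤ G (n+1) + 3/n, where V i = i / A i and G n = A (n+1) / (A n + n).
    V-cross : ∀ {n i j} → 1 ≤ n → n ≤ i → n ≤ j → j * (A i * n) ≤ (i * n + 1 * A i) * A j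
    V-cross {n} {i} {j} 1≤n n≤i n≤j = begin
      j * (A i * n)           ≡⟨ *-assoc j (A i) n ⟨
      j * A i * n             ≤⟨ *-monoˡ-≤ n (<⇒≤ (A-cross 1≤i 1≤j)) ⟩
      i * suc (A j) * n       ≡⟨ expand i (A j) n ⟩
      i * n * A j + i * n     ≤⟨ +-monoʳ-≤ (i * n * A j) (*-mono-≤ (n≤A 1≤i) (≤-trans n≤j (n≤A 1≤j))) ⟩
      i * n * A j + A i * A j ≡⟨ collect i n (A i) (A j) ⟩
      (i * n + 1 * A i) * A j ∎
      where
      open ≤-Reasoning
      1≤i : 1 ≤ i
      1≤i = ≤-trans 1≤n n≤i
      1≤j : 1 ≤ j
      1≤j = ≤-trans 1≤n n≤j
      expand : ∀ i x n → i * suc x * n ≡ i * n * x + i * n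
      expand = solve-∀
      collect : ∀ i n x y → i * n * y + x * y ≡ (i * n + 1 * x) * y
      collect = solve-∀

    G-bound-cross : ∀ {n} → 1 ≤ n → A (suc n) * 1 ≤ 2 * (A n + n)
    G-bound-cross {n} 1≤n = begin
      A (suc n) * 1           ≡⟨ *-identityʳ (A (suc n)) ⟩
      A (suc n)               ≤⟨ A-suc≤A+2 1≤n ⟩
      A n + 2                 ≤⟨ +-mono-≤ (m≤m+n (A n) n) (+-mono-≤ (≤-trans 1≤n (n≤A 1≤n)) 1≤n) ⟩
      (A n + n) + (A n + n)   ≡⟨ cong ((A n + n) +_) (+-identityʳ (A n + n)) ⟨
      2 * (A n + n)           ∎
      where open ≤-Reasoning

    G-step-cross-up : ∀ {n} → 1 ≤ n →
      A (suc (suc n)) * ((A n + n) * n) ≤ (A (suc n) * n + 3 * (A n + n)) * (A (suc n) + suc n)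
    G-step-cross-up {n} 1≤n = begin
      x₂ * (y₀ * n)                 ≤⟨ *-monoˡ-≤ (y₀ * n) (A-suc≤A+2 (s≤s z≤n)) ⟩
      (x₁ + 2) * (y₀ * n)           ≡⟨ expand x₁ y₀ n ⟩
      x₁ * n * y₀ + 2 * n * y₀      ≤⟨ +-mono-≤ (*-monoʳ-≤ (x₁ * n) y₀≤y₁)
                                               (*-monoˡ-≤ y₀ (*-mono-≤ (n≤1+n 2) n≤y₁)) ⟩
      x₁ * n * y₁ + 3 * y₁ * y₀     ≡⟨ collect x₁ n y₀ y₁ ⟩
      (x₁ * n + 3 * y₀) * y₁        ∎
      where
      open ≤-Reasoning
      x₁ x₂ y₀ y₁ : ℕ
      x₁ = A (suc n)
      x₂ = A (suc (suc n))
      y₀ = A n + n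
      y₁ = x₁ + suc n
      y₀≤y₁ : y₀ ≤ y₁
      y₀≤y₁ = +-mono-≤ (<⇒≤ (A-increasing 1≤n)) (n≤1+n n)
      n≤y₁ : n ≤ y₁
      n≤y₁ = ≤-trans (n≤1+n n) (m≤n+m (suc n) x₁)
      expand : ∀ x y n → (x + 2) * (y * n) ≡ x * n * y + 2 * n * y
      expand = solve-∀
      collect : ∀ x n y z → x * n * z + 3 * z * y ≡ (x * n + 3 * y) * z
      collect = solve-∀

    G-step-cross-down : ∀ {n} → 1 ≤ n →
      A (suc n) * ((A (suc n) + suc n) * n) ≤ (A (suc (suc n)) * n + 3 * (A (suc n) + suc n)) * (A n + n)
    G-step-cross-down {n} 1≤n = begin
      x₁ * (y₁ * n)                 ≤⟨ *-monoʳ-≤ x₁ (*-monoˡ-≤ n y₁≤y₀+3) ⟩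
      x₁ * ((y₀ + 3) * n)           ≡⟨ expand x₁ y₀ n ⟩
      x₁ * n * y₀ + 3 * (x₁ * n)    ≤⟨ +-mono-≤ (*-monoˡ-≤ y₀ (*-monoˡ-≤ n (<⇒≤ (A-increasing (s≤s z≤n)))))
                                               (*-monoʳ-≤ 3 (*-mono-≤ (m≤m+n x₁ (suc n)) (m≤n+m n (A n)))) ⟩
      x₂ * n * y₀ + 3 * (y₁ * y₀)   ≡⟨ collect x₂ n y₀ y₁ ⟩
      (x₂ * n + 3 * y₁) * y₀        ∎
      where
      open ≤-Reasoning
      x₁ x₂ y₀ y₁ : ℕ
      x₁ = A (suc n)
      x₂ = A (suc (suc n))
      y₀ = A n + n
      y₁ = x₁ + suc n
      regroup : ∀ x n → x + 2 + suc n ≡ x + n + 3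
      regroup = solve-∀
      y₁≤y₀+3 : y₁ ≤ y₀ + 3
      y₁≤y₀+3 = ≤-trans (+-monoˡ-≤ (suc n) (A-suc≤A+2 1≤n)) (≤-reflexive (regroup (A n) n))
      expand : ∀ x y n → x * ((y + 3) * n) ≡ x * n * y + 3 * (x * n)
      expand = solve-∀
      collect : ∀ x n y z → x * n * y + 3 * (z * y) ≡ (x * n + 3 * z) * y
      collect = solve-∀

open import Data.Nat as ℕ using (ℕ; zero; suc; s≤s; z≤n)
import Data.Nat
import Data.Nat.Properties as ℕP
import Data.Nat.Tactic.RingSolver as ℕ-Solver
open import Data.Integer as ℤ using (+_)
import Data.Integer.Properties as ℤP
open import Data.Rational as ℚ using (ℚ; mkℚ; 0ℚ; _+_; _*_; _-_; _≤_; _<_; ∣_∣; toℚᵘ)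
import Data.Rational.Properties as ℚP
open import Data.Rational.Solver using (module +-*-Solver)
open +-*-Solver using (solve; _:+_; _:-_; _:*_; :-_; _:=_)
open import Data.Rational.Unnormalised as ℚᵘ using (mkℚᵘ; *≤*; *<*)
import Data.Rational.Unnormalised.Properties as ℚᵘP
open import Data.Product using (Σ; _,_)
open import Data.Sum using (inj₁; inj₂)
open import Relation.Binary.PropositionalEquality

-[p-q]≡q-p : ∀ p q → ℚ.- (p - q) ≡ q - p
-[p-q]≡q-p = solve 2 (λ p q → :- (p :- q) := q :- p) refl

∣p-q∣≡∣q-p∣ : ∀ p q → ∣ p - q ∣ ≡ ∣ q - p ∣
∣p-q∣≡∣q-p∣ p q = trans (sym (ℚP.∣-p∣≡∣p∣ (p - q))) (cong ∣_∣ (-[p-q]≡q-p p q))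

∣p-r∣≤∣p-q∣+∣q-r∣ : ∀ p q r → ∣ p - r ∣ ≤ ∣ p - q ∣ + ∣ q - r ∣
∣p-r∣≤∣p-q∣+∣q-r∣ p q r =
  subst (λ x → ∣ x ∣ ≤ ∣ p - q ∣ + ∣ q - r ∣) (chain p q r) (ℚP.∣p+q∣≤∣p∣+∣q∣ (p - q) (q - r))
  where
  chain : ∀ p q r → (p - q) + (q - r) ≡ p - r
  chain = solve 3 (λ p q r → (p :- q) :+ (q :- r) := p :- r) refl

p≤q+r⇒p-q≤r : ∀ {p q r} → p ≤ q + r → p - q ≤ r
p≤q+r⇒p-q≤r {p} {q} {r} p≤q+r = ℚP.≤-trans (ℚP.+-monoˡ-≤ (ℚ.- q) p≤q+r) (ℚP.≤-reflexive (cancel q r))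
  where
  cancel : ∀ q r → q + r - q ≡ r
  cancel = solve 2 (λ q r → q :+ r :- q := r) refl

∣p-q∣≤r : ∀ {p q r} → p ≤ q + r → q ≤ p + r → ∣ p - q ∣ ≤ r
∣p-q∣≤r {p} {q} {r} p≤q+r q≤p+r with ℚP.∣p∣≡p∨∣p∣≡-p (p - q)
... | inj₁ ∣p-q∣≡p-q    = subst (_≤ r) (sym ∣p-q∣≡p-q) (p≤q+r⇒p-q≤r p≤q+r)
... | inj₂ ∣p-q∣≡-[p-q] = subst (_≤ r) (sym (trans ∣p-q∣≡-[p-q] (-[p-q]≡q-p p q))) (p≤q+r⇒p-q≤r q≤p+r)

p≡q+r⇒p-r≡q : ∀ {p q r} → p ≡ q + r → p - r ≡ q
p≡q+r⇒p-r≡q {p} {q} {r} refl = solve 2 (λ q r → q :+ r :- r := q) refl q r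

p+s≡r+q⇒p-q≡r-s : ∀ p q r s → p + s ≡ r + q → p - q ≡ r - s
p+s≡r+q⇒p-q≡r-s p q r s p+s≡r+q = begin
  p - q             ≡⟨ pad p q s ⟩
  (p + s) - (q + s) ≡⟨ cong (_- (q + s)) p+s≡r+q ⟩
  (r + q) - (q + s) ≡⟨ unpad r q s ⟩
  r - s             ∎
  where
  open ≡-Reasoning
  pad : ∀ p q s → p - q ≡ (p + s) - (q + s)
  pad = solve 3 (λ p q s → p :- q := (p :+ s) :- (q :+ s)) refl
  unpad : ∀ r q s → (r + q) - (q + s) ≡ r - s
  unpad = solve 3 (λ r q s → (r :+ q) :- (q :+ s) := r :- s) refl

p-q≤p : ∀ p {q} → 0ℚ ≤ q → p - q ≤ p
p-q≤p p {q} 0≤q = p≤q+r⇒p-q≤r (subst (_≤ q + p) (ℚP.+-identityˡ p) (ℚP.+-monoˡ-≤ p 0≤q))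

*-mono-≤-nonNeg : ∀ {p q r s} → 0ℚ ≤ p → 0ℚ ≤ s → p ≤ q → r ≤ s → p * r ≤ q * s
*-mono-≤-nonNeg {p} {q} {r} {s} 0≤p 0≤s p≤q r≤s = ℚP.≤-trans
  (ℚP.*-monoˡ-≤-nonNeg p {{ℚ.nonNegative 0≤p}} r≤s)
  (ℚP.*-monoʳ-≤-nonNeg s {{ℚ.nonNegative 0≤s}} p≤q)

toℚᵘ-frac : ∀ a b → toℚᵘ (frac a (suc b)) ℚᵘ.≃ mkℚᵘ (+ a) b
toℚᵘ-frac a b = ℚP.toℚᵘ-fromℚᵘ (mkℚᵘ (+ a) b)

frac-≤ : ∀ a b c d → 1 ℕ.≤ b → 1 ℕ.≤ d → a ℕ.* d ℕ.≤ c ℕ.* b → frac a b ≤ frac c d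
frac-≤ a (suc b) c (suc d) _ _ ad≤cb = ℚP.toℚᵘ-cancel-≤
  (ℚᵘP.≤-respˡ-≃ (ℚᵘP.≃-sym (toℚᵘ-frac a b)) (ℚᵘP.≤-respʳ-≃ (ℚᵘP.≃-sym (toℚᵘ-frac c d))
    (*≤* (subst₂ ℤ._≤_ (ℤP.pos-* a (suc d)) (ℤP.pos-* c (suc b)) (ℤ.+≤+ ad≤cb)))))

frac-< : ∀ a b c d → 1 ℕ.≤ b → 1 ℕ.≤ d → a ℕ.* d ℕ.< c ℕ.* b → frac a b < frac c d
frac-< a (suc b) c (suc d) _ _ ad<cb = ℚP.toℚᵘ-cancel-<
  (ℚᵘP.<-respˡ-≃ (ℚᵘP.≃-sym (toℚᵘ-frac a b)) (ℚᵘP.<-respʳ-≃ (ℚᵘP.≃-sym (toℚᵘ-frac c d))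
    (*<* (subst₂ ℤ._<_ (ℤP.pos-* a (suc d)) (ℤP.pos-* c (suc b)) (ℤ.+<+ ad<cb)))))

frac-cong : ∀ a b c d → 1 ℕ.≤ b → 1 ℕ.≤ d → a ℕ.* d ≡ c ℕ.* b → frac a b ≡ frac c d
frac-cong a b c d 1≤b 1≤d ad≡cb =
  ℚP.≤-antisym (frac-≤ a b c d 1≤b 1≤d (ℕP.≤-reflexive ad≡cb))
               (frac-≤ c d a b 1≤d 1≤b (ℕP.≤-reflexive (sym ad≡cb)))

frac-nonNeg : ∀ a b → 0ℚ ≤ frac a b
frac-nonNeg a zero = ℚP.≤-refl
frac-nonNeg a (suc b) = frac-≤ 0 1 a (suc b) (s≤s z≤n) (s≤s z≤n) z≤n

frac-+ : ∀ a b c d → 1 ℕ.≤ b → 1 ℕ.≤ d → frac a b + frac c d ≡ frac (a ℕ.* d ℕ.+ c ℕ.* b) (b ℕ.* d)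
frac-+ a (suc b) c (suc d) _ _ = ℚP.toℚᵘ-injective (begin
    toℚᵘ (frac a (suc b) + frac c (suc d))
  ≈⟨ ℚP.toℚᵘ-homo-+ (frac a (suc b)) (frac c (suc d)) ⟩
    toℚᵘ (frac a (suc b)) ℚᵘ.+ toℚᵘ (frac c (suc d))
  ≈⟨ ℚᵘP.+-cong (toℚᵘ-frac a b) (toℚᵘ-frac c d) ⟩
    mkℚᵘ (+ a) b ℚᵘ.+ mkℚᵘ (+ c) d
  ≡⟨ cong (λ n → mkℚᵘ n (d ℕ.+ b ℕ.* suc d)) numerator ⟩
    mkℚᵘ (+ (a ℕ.* suc d ℕ.+ c ℕ.* suc b)) (d ℕ.+ b ℕ.* suc d)
  ≈⟨ ℚᵘP.≃-sym (toℚᵘ-frac _ _) ⟩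
    toℚᵘ (frac (a ℕ.* suc d ℕ.+ c ℕ.* suc b) (suc b ℕ.* suc d))
  ∎)
  where
  open ℚᵘP.≃-Reasoning
  numerator : + a ℤ.* + suc d ℤ.+ + c ℤ.* + suc b ≡ + (a ℕ.* suc d ℕ.+ c ℕ.* suc b)
  numerator = trans (cong₂ ℤ._+_ (sym (ℤP.pos-* a (suc d))) (sym (ℤP.pos-* c (suc b))))
                    (sym (ℤP.pos-+ (a ℕ.* suc d) (c ℕ.* suc b)))

frac-* : ∀ a b c d → frac a b * frac c d ≡ frac (a ℕ.* c) (b ℕ.* d)
frac-* a zero c d = ℚP.*-zeroˡ (frac c d)
frac-* a (suc b) c zero rewrite ℕP.*-zeroʳ b = ℚP.*-zeroʳ (frac a (suc b))
frac-* a (suc b) c (suc d) = ℚP.toℚᵘ-injective (begin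
    toℚᵘ (frac a (suc b) * frac c (suc d))
  ≈⟨ ℚP.toℚᵘ-homo-* (frac a (suc b)) (frac c (suc d)) ⟩
    toℚᵘ (frac a (suc b)) ℚᵘ.* toℚᵘ (frac c (suc d))
  ≈⟨ ℚᵘP.*-cong (toℚᵘ-frac a b) (toℚᵘ-frac c d) ⟩
    mkℚᵘ (+ a) b ℚᵘ.* mkℚᵘ (+ c) d
  ≡⟨ cong (λ n → mkℚᵘ n (d ℕ.+ b ℕ.* suc d)) (sym (ℤP.pos-* a c)) ⟩
    mkℚᵘ (+ (a ℕ.* c)) (d ℕ.+ b ℕ.* suc d)
  ≈⟨ ℚᵘP.≃-sym (toℚᵘ-frac _ _) ⟩
    toℚᵘ (frac (a ℕ.* c) (suc b ℕ.* suc d))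
  ∎)
  where open ℚᵘP.≃-Reasoning

frac-+-same : ∀ a b n → 1 ℕ.≤ n → frac a n + frac b n ≡ frac (a ℕ.+ b) n
frac-+-same a b n 1≤n =
  trans (frac-+ a n b n 1≤n 1≤n) (frac-cong _ _ _ _ (ℕP.*-mono-≤ 1≤n 1≤n) 1≤n (regroup a b n))
  where
  regroup : ∀ a b n → (a ℕ.* n ℕ.+ b ℕ.* n) ℕ.* n ≡ (a ℕ.+ b) ℕ.* (n ℕ.* n)
  regroup = ℕ-Solver.solve-∀

frac-≤-+ : ∀ a b c d e f → 1 ℕ.≤ b → 1 ℕ.≤ d → 1 ℕ.≤ f →
           a ℕ.* (d ℕ.* f) ℕ.≤ (c ℕ.* f ℕ.+ e ℕ.* d) ℕ.* b → frac a b ≤ frac c d + frac e f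
frac-≤-+ a b c d e f 1≤b 1≤d 1≤f cross =
  subst (frac a b ≤_) (sym (frac-+ c d e f 1≤d 1≤f)) (frac-≤ a b _ _ 1≤b (ℕP.*-mono-≤ 1≤d 1≤f) cross)

frac-*-frac-suc : ∀ c {n} → 1 ℕ.≤ n → frac c n * frac 1 (suc n) ≡ frac c n - frac c (suc n)
frac-*-frac-suc c {n} 1≤n = sym (p≡q+r⇒p-r≡q (begin
    frac c n
      ≡⟨ frac-cong _ _ _ _ 1≤n (ℕP.*-mono-≤ 1≤n²+n (s≤s z≤n)) (split c n) ⟩
    frac (c ℕ.* 1 ℕ.* suc n ℕ.+ c ℕ.* (n ℕ.* suc n)) (n ℕ.* suc n ℕ.* suc n)
      ≡⟨ frac-+ (c ℕ.* 1) (n ℕ.* suc n) c (suc n) 1≤n²+n (s≤s z≤n) ⟨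
    frac (c ℕ.* 1) (n ℕ.* suc n) + frac c (suc n)
      ≡⟨ cong (_+ frac c (suc n)) (frac-* c n 1 (suc n)) ⟨
    frac c n * frac 1 (suc n) + frac c (suc n)
      ∎))
  where
  open ≡-Reasoning
  1≤n²+n : 1 ℕ.≤ n ℕ.* suc n
  1≤n²+n = ℕP.*-mono-≤ 1≤n (s≤s z≤n)
  split : ∀ c n → c ℕ.* (n ℕ.* suc n ℕ.* suc n) ≡ (c ℕ.* 1 ℕ.* suc n ℕ.+ c ℕ.* (n ℕ.* suc n)) ℕ.* n
  split = ℕ-Solver.solve-∀

∣-∣-telescope : ∀ (T f : ℕ → ℚ) {N M} → N ℕ.≤ M →
                (∀ {k} → N ℕ.≤ k → k ℕ.< M → ∣ T (suc k) - T k ∣ ≤ f k - f (suc k)) →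
                ∣ T M - T N ∣ ≤ f N - f M
∣-∣-telescope T f N≤M = go (ℕP.≤⇒≤′ N≤M)
  where
  go : ∀ {N M} → N ℕ.≤′ M → (∀ {k} → N ℕ.≤ k → k ℕ.< M → ∣ T (suc k) - T k ∣ ≤ f k - f (suc k)) →
       ∣ T M - T N ∣ ≤ f N - f M
  go {N} ℕ.≤′-refl _ = ℚP.≤-reflexive (trans (cong ∣_∣ (ℚP.+-inverseʳ (T N))) (sym (ℚP.+-inverseʳ (f N))))
  go {N} (ℕ.≤′-step {M} N≤′M) step = begin
    ∣ T (suc M) - T N ∣                  ≤⟨ ∣p-r∣≤∣p-q∣+∣q-r∣ (T (suc M)) (T M) (T N) ⟩
    ∣ T (suc M) - T M ∣ + ∣ T M - T N ∣  ≤⟨ ℚP.+-mono-≤ (step (ℕP.≤′⇒≤ N≤′M) ℕP.≤-refl)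
                                             (go N≤′M λ N≤k k<M → step N≤k (ℕP.m≤n⇒m≤1+n k<M)) ⟩
    (f M - f (suc M)) + (f N - f M)      ≡⟨ collapse (f N) (f M) (f (suc M)) ⟩
    f N - f (suc M)                      ∎
    where
    open ℚP.≤-Reasoning
    collapse : ∀ a b c → (b - c) + (a - b) ≡ a - c
    collapse = solve 3 (λ a b c → (b :- c) :+ (a :- b) := a :- c) refl

IsCauchy : (ℕ → ℚ) → Set
IsCauchy S = (ε : ℚ) → 0ℚ < ε → Σ ℕ λ N → (m n : ℕ) → N ℕ.≤ m → N ℕ.≤ n → ∣ S m - S n ∣ < ε

tail-bound⇒cauchy : ∀ (S : ℕ → ℚ) L → (∀ {N m} → 1 ℕ.≤ N → N ℕ.≤ m → ∣ S m - S N ∣ ≤ frac L N) →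
                    IsCauchy S
tail-bound⇒cauchy S L tail ε@(mkℚ (+ suc e) d _) _ = N , λ m n N≤m N≤n → begin-strict
    ∣ S m - S n ∣                  ≤⟨ ∣p-r∣≤∣p-q∣+∣q-r∣ (S m) (S N) (S n) ⟩
    ∣ S m - S N ∣ + ∣ S N - S n ∣  ≤⟨ ℚP.+-mono-≤ (tail 1≤N N≤m)
                                       (subst (_≤ frac L N) (∣p-q∣≡∣q-p∣ (S n) (S N)) (tail 1≤N N≤n)) ⟩
    frac L N + frac L N            ≡⟨ frac-+-same L L N 1≤N ⟩
    frac (L ℕ.+ L) N               <⟨ frac-< (L ℕ.+ L) N (suc e) (suc d) 1≤N (s≤s z≤n) cross ⟩
    frac (suc e) (suc d)           ≡⟨ ℚP.↥p/↧p≡p ε ⟩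
    ε                              ∎
  where
  open ℚP.≤-Reasoning
  N : ℕ
  N = suc ((L ℕ.+ L) ℕ.* suc d)
  1≤N : 1 ℕ.≤ N
  1≤N = s≤s z≤n
  cross : (L ℕ.+ L) ℕ.* suc d ℕ.< suc e ℕ.* N
  cross = ℕP.<-≤-trans (ℕP.n<1+n _) (ℕP.m≤n*m N (suc e))
tail-bound⇒cauchy S L tail (mkℚ (+ zero) _ _) (ℚ.*<* (ℤ.+<+ ()))
tail-bound⇒cauchy S L tail (mkℚ ℤ.-[1+ _ ] _ _) (ℚ.*<* ())

module SummationByParts
  (S V G : ℕ → ℚ) (K C : ℕ)
  (S-suc : ∀ n → S (suc n) ≡ S n + G (suc n) * (V (suc n) - V (suc (suc n))))
  (V-cauchy : ∀ {n m} → 1 ℕ.≤ n → n ℕ.≤ m → ∣ V m - V n ∣ ≤ frac 1 n)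
  (G-bounded : ∀ {n} → 1 ℕ.≤ n → ∣ G n ∣ ≤ frac K 1)
  (G-step : ∀ {n} → 1 ℕ.≤ n → ∣ G (suc n) - G n ∣ ≤ frac C n)
  where

  corrected : ℚ → ℕ → ℚ
  corrected c k = S k + G k * (V (suc k) - c)

  corrected-suc : ∀ c k → corrected c (suc k) - corrected c k ≡ (G (suc k) - G k) * (V (suc k) - c)
  corrected-suc c k =
    trans (cong (λ s → s + G (suc k) * (V (suc (suc k)) - c) - corrected c k) (S-suc k))
          (abel (S k) (G k) (G (suc k)) (V (suc k)) (V (suc (suc k))) c)
    where
    abel : ∀ s g₀ g₁ v₁ v₂ c →
           s + g₁ * (v₁ - v₂) + g₁ * (v₂ - c) - (s + g₀ * (v₁ - c)) ≡ (g₁ - g₀) * (v₁ - c)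
    abel = solve 6 (λ s g₀ g₁ v₁ v₂ c →
      s :+ g₁ :* (v₁ :- v₂) :+ g₁ :* (v₂ :- c) :- (s :+ g₀ :* (v₁ :- c)) := (g₁ :- g₀) :* (v₁ :- c)) refl

  corrected-step : ∀ {M k} → 1 ℕ.≤ k → k ℕ.< M →
    ∣ corrected (V (suc M)) (suc k) - corrected (V (suc M)) k ∣ ≤ frac C k - frac C (suc k)
  corrected-step {M} {k} 1≤k k<M = begin
    ∣ corrected (V (suc M)) (suc k) - corrected (V (suc M)) k ∣
      ≡⟨ cong ∣_∣ (corrected-suc (V (suc M)) k) ⟩
    ∣ (G (suc k) - G k) * (V (suc k) - V (suc M)) ∣
      ≡⟨ ℚP.∣p*q∣≡∣p∣*∣q∣ (G (suc k) - G k) (V (suc k) - V (suc M)) ⟩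
    ∣ G (suc k) - G k ∣ * ∣ V (suc k) - V (suc M) ∣
      ≤⟨ *-mono-≤-nonNeg (ℚP.0≤∣p∣ (G (suc k) - G k)) (frac-nonNeg 1 (suc k)) (G-step 1≤k) V-close ⟩
    frac C k * frac 1 (suc k)
      ≡⟨ frac-*-frac-suc C 1≤k ⟩
    frac C k - frac C (suc k)
      ∎
    where
    open ℚP.≤-Reasoning
    V-close : ∣ V (suc k) - V (suc M) ∣ ≤ frac 1 (suc k)
    V-close = subst (_≤ frac 1 (suc k)) (∣p-q∣≡∣q-p∣ (V (suc M)) (V (suc k)))
                    (V-cauchy (s≤s z≤n) (s≤s (ℕP.<⇒≤ k<M)))

  S-tail : ∀ {N M} → 1 ℕ.≤ N → N ℕ.≤ M → ∣ S M - S N ∣ ≤ frac (C ℕ.+ K) N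
  S-tail {N} {M} 1≤N N≤M = begin
    ∣ S M - S N ∣                               ≡⟨ cong ∣_∣ (split (S M) (S N) (G M) (G N) (V (suc N)) c) ⟩
    ∣ Δcorrected + G N * (V (suc N) - c) ∣      ≤⟨ ℚP.∣p+q∣≤∣p∣+∣q∣ Δcorrected (G N * (V (suc N) - c)) ⟩
    ∣ Δcorrected ∣ + ∣ G N * (V (suc N) - c) ∣  ≤⟨ ℚP.+-mono-≤ telescoped boundary ⟩
    (frac C N - frac C M) + frac K N            ≤⟨ ℚP.+-monoˡ-≤ (frac K N) (p-q≤p (frac C N) (frac-nonNeg C M)) ⟩
    frac C N + frac K N                         ≡⟨ frac-+-same C K N 1≤N ⟩
    frac (C ℕ.+ K) N                            ∎
    where
    open ℚP.≤-Reasoning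
    c Δcorrected : ℚ
    c = V (suc M)
    Δcorrected = corrected c M - corrected c N
    split : ∀ sM sN gM gN v c → sM - sN ≡ (sM + gM * (c - c) - (sN + gN * (v - c))) + gN * (v - c)
    split = solve 6 (λ sM sN gM gN v c →
      sM :- sN := (sM :+ gM :* (c :- c) :- (sN :+ gN :* (v :- c))) :+ gN :* (v :- c)) refl
    telescoped : ∣ Δcorrected ∣ ≤ frac C N - frac C M
    telescoped = ∣-∣-telescope (corrected c) (frac C) N≤M
      λ N≤k k<M → corrected-step (ℕP.≤-trans 1≤N N≤k) k<M
    V-close : ∣ V (suc N) - c ∣ ≤ frac 1 (suc N)
    V-close = subst (_≤ frac 1 (suc N)) (∣p-q∣≡∣q-p∣ c (V (suc N))) (V-cauchy (s≤s z≤n) (s≤s N≤M))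
    cross : K ℕ.* 1 ℕ.* N ℕ.≤ K ℕ.* (1 ℕ.* suc N)
    cross = subst₂ ℕ._≤_ (cong (ℕ._* N) (sym (ℕP.*-identityʳ K))) (cong (K ℕ.*_) (sym (ℕP.*-identityˡ (suc N))))
                         (ℕP.*-monoʳ-≤ K (ℕP.n≤1+n N))
    boundary : ∣ G N * (V (suc N) - c) ∣ ≤ frac K N
    boundary = begin
      ∣ G N * (V (suc N) - c) ∣     ≡⟨ ℚP.∣p*q∣≡∣p∣*∣q∣ (G N) (V (suc N) - c) ⟩
      ∣ G N ∣ * ∣ V (suc N) - c ∣   ≤⟨ *-mono-≤-nonNeg (ℚP.0≤∣p∣ (G N)) (frac-nonNeg 1 (suc N))
                                                        (G-bounded 1≤N) V-close ⟩
      frac K 1 * frac 1 (suc N)     ≡⟨ frac-* K 1 1 (suc N) ⟩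
      frac (K ℕ.* 1) (1 ℕ.* suc N)  ≤⟨ frac-≤ (K ℕ.* 1) (1 ℕ.* suc N) K N (s≤s z≤n) 1≤N cross ⟩
      frac K N                      ∎

V : (ℕ → ℕ) → ℕ → ℚ
V A n = frac n (A n)

G : (ℕ → ℕ) → ℕ → ℚ
G A n = frac (A (suc n)) (A n ℕ.+ n)

module _ {A : ℕ → ℕ} (A-floor : IsFloorA A) where

  1≤A : ∀ {n} → 1 ℕ.≤ n → 1 ℕ.≤ A n
  1≤A 1≤n = ℕP.≤-trans 1≤n (n≤A A-floor 1≤n)

  B≡A+id : ∀ {B} → IsFloorB B → ∀ {n} → 1 ℕ.≤ n → B n ≡ A n ℕ.+ n
  B≡A+id B-floor {suc m} 1≤n = floorHalf-unique (B-floor (suc m) 1≤n) (floorHalf-shift (A-floor (suc m) 1≤n))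

  term≡G*ΔV : ∀ {B} → IsFloorB B → ∀ {n} → 1 ℕ.≤ n → term A B n ≡ G A n * (V A n - V A (suc n))
  term≡G*ΔV {B} B-floor {n} 1≤n = begin
    term A B n
      ≡⟨ cong₂ (λ b₁ b₀ → frac y x - frac b₁ b₀) (B≡A+id B-floor (s≤s z≤n)) (B≡A+id B-floor 1≤n) ⟩
    frac y x - frac (y ℕ.+ suc n) (x ℕ.+ n)
      ≡⟨ p+s≡r+q⇒p-q≡r-s (frac y x) (frac (y ℕ.+ suc n) (x ℕ.+ n)) (frac (y ℕ.* n) ((x ℕ.+ n) ℕ.* x))
                           (frac (y ℕ.* suc n) ((x ℕ.+ n) ℕ.* y)) cross-sum ⟩
    frac (y ℕ.* n) ((x ℕ.+ n) ℕ.* x) - frac (y ℕ.* suc n) ((x ℕ.+ n) ℕ.* y)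
      ≡⟨ cong₂ _-_ (frac-* y (x ℕ.+ n) n x) (frac-* y (x ℕ.+ n) (suc n) y) ⟨
    frac y (x ℕ.+ n) * frac n x - frac y (x ℕ.+ n) * frac (suc n) y
      ≡⟨ distrib (frac y (x ℕ.+ n)) (frac n x) (frac (suc n) y) ⟨
    G A n * (V A n - V A (suc n))
      ∎
    where
    open ≡-Reasoning
    x y : ℕ
    x = A n
    y = A (suc n)
    1≤x : 1 ℕ.≤ x
    1≤x = 1≤A 1≤n
    1≤y : 1 ℕ.≤ y
    1≤y = 1≤A (s≤s z≤n)
    1≤x+n : 1 ℕ.≤ x ℕ.+ n
    1≤x+n = ℕP.≤-trans 1≤n (ℕP.m≤n+m n x)
    distrib : ∀ a b c → a * (b - c) ≡ a * b - a * c
    distrib = solve 3 (λ a b c → a :* (b :- c) := a :* b :- a :* c) refl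
    cross-identity : ∀ x y n →
      (y ℕ.* ((x ℕ.+ n) ℕ.* y) ℕ.+ y ℕ.* suc n ℕ.* x) ℕ.* ((x ℕ.+ n) ℕ.* x ℕ.* (x ℕ.+ n)) ≡
      (y ℕ.* n ℕ.* (x ℕ.+ n) ℕ.+ (y ℕ.+ suc n) ℕ.* ((x ℕ.+ n) ℕ.* x)) ℕ.* (x ℕ.* ((x ℕ.+ n) ℕ.* y))
    cross-identity = ℕ-Solver.solve-∀
    cross-sum : frac y x + frac (y ℕ.* suc n) ((x ℕ.+ n) ℕ.* y) ≡
                frac (y ℕ.* n) ((x ℕ.+ n) ℕ.* x) + frac (y ℕ.+ suc n) (x ℕ.+ n)
    cross-sum = trans (frac-+ _ _ _ _ 1≤x (ℕP.*-mono-≤ 1≤x+n 1≤y))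
                (trans (frac-cong _ _ _ _ (ℕP.*-mono-≤ 1≤x (ℕP.*-mono-≤ 1≤x+n 1≤y))
                                          (ℕP.*-mono-≤ (ℕP.*-mono-≤ 1≤x+n 1≤x) 1≤x+n) (cross-identity x y n))
                       (sym (frac-+ _ _ _ _ (ℕP.*-mono-≤ 1≤x+n 1≤x) 1≤x+n)))

  V-le : ∀ {n i j} → 1 ℕ.≤ n → n ℕ.≤ i → n ℕ.≤ j → V A j ≤ V A i + frac 1 n
  V-le {n} {i} {j} 1≤n n≤i n≤j = frac-≤-+ j (A j) i (A i) 1 n
    (1≤A (ℕP.≤-trans 1≤n n≤j)) (1≤A (ℕP.≤-trans 1≤n n≤i)) 1≤n (V-cross A-floor 1≤n n≤i n≤j)

  V-cauchy : ∀ {n m} → 1 ℕ.≤ n → n ℕ.≤ m → ∣ V A m - V A n ∣ ≤ frac 1 n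
  V-cauchy 1≤n n≤m = ∣p-q∣≤r (V-le 1≤n ℕP.≤-refl n≤m) (V-le 1≤n n≤m ℕP.≤-refl)

  G-bounded : ∀ {n} → 1 ℕ.≤ n → ∣ G A n ∣ ≤ frac 2 1
  G-bounded {n} 1≤n = subst (_≤ frac 2 1) (sym (ℚP.0≤p⇒∣p∣≡p (frac-nonNeg (A (suc n)) (A n ℕ.+ n))))
    (frac-≤ (A (suc n)) (A n ℕ.+ n) 2 1 (ℕP.≤-trans 1≤n (ℕP.m≤n+m n (A n))) (s≤s z≤n) (G-bound-cross A-floor 1≤n))

  G-step : ∀ {n} → 1 ℕ.≤ n → ∣ G A (suc n) - G A n ∣ ≤ frac 3 n
  G-step {n} 1≤n = ∣p-q∣≤r
    (frac-≤-+ x₂ y₁ x₁ y₀ 3 n 1≤y₁ 1≤y₀ 1≤n (G-step-cross-up A-floor 1≤n))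
    (frac-≤-+ x₁ y₀ x₂ y₁ 3 n 1≤y₀ 1≤y₁ 1≤n (G-step-cross-down A-floor 1≤n))
    where
    x₁ x₂ y₀ y₁ : ℕ
    x₁ = A (suc n)
    x₂ = A (suc (suc n))
    y₀ = A n ℕ.+ n
    y₁ = x₁ ℕ.+ suc n
    1≤y₀ : 1 ℕ.≤ y₀
    1≤y₀ = ℕP.≤-trans 1≤n (ℕP.m≤n+m n (A n))
    1≤y₁ : 1 ℕ.≤ y₁
    1≤y₁ = ℕP.≤-trans (s≤s z≤n) (ℕP.m≤n+m (suc n) x₁)

theorem1 : (A B : ℕ → ℕ) → IsFloorA A → IsFloorB B →
    (ε : ℚ) → 0ℚ < ε →
      Σ ℕ (λ N → (m n : ℕ) → N Data.Nat.≤ m → N Data.Nat.≤ n →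
        ∣ partialSum A B m - partialSum A B n ∣ < ε)
theorem1 A B A-floor B-floor = tail-bound⇒cauchy (partialSum A B) (3 ℕ.+ 2) S-tail
  where
  open SummationByParts (partialSum A B) (V A) (G A) 2 3
    (λ n → cong (λ t → partialSum A B n + t) (term≡G*ΔV A-floor B-floor (s≤s z≤n)))
    (V-cauchy A-floor) (G-bounded A-floor) (G-step A-floor)
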